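{- Let $C_n$ denote the cycle of length $n$ ($n\ge 3$). Then $\mathsf{DL}(C_n) = (n-1)/2$ if $n$ is odd, and $\mathsf{DL}(C_n) = (n-2)/2$ if $n$ is even.
   Context: For a finite connected graph $G=(V,E)$ with $|V|=n$ and graph distance $d$, a $k$-dispersed labelling is a bijection $\phi:\{1,\dots,n\}\to V$ with $d(\phi(i),\phi(i+1))\ge k$ for $1\le i\le n-1$. $\mathsf{DL}(G)$ is the maximum $k$ such that $G$ has a $k$-dispersed labelling. -}

module Defs where

open import Data.Nat using (ℕ; zero; suc; _≤_; _∸_)
open import Data.Fin using (Fin; toℕ)
open import Data.Product using (_×_; ∃)
open import Data.Sum using (_⊎_)
open import Function.Definitions using (Bijective)
open import Relation.Binary.PropositionalEquality using (_≡_)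

record Graph (n : ℕ) : Set₁ where
  field
    Adj : Fin n → Fin n → Set
open Graph public

data Walk {n : ℕ} (G : Graph n) : Fin n → Fin n → Set where
  [] : ∀ {u} → Walk G u u
  _∷_ : ∀ {u v w} → Adj G u v → Walk G v w → Walk G u w

walkLength : ∀ {n} {G : Graph n} {u v : Fin n} → Walk G u v → ℕ
walkLength [] = 0
walkLength (_ ∷ w) = suc (walkLength w)

Connected : ∀ {n} → Graph n → Set
Connected G = ∀ u v → Walk G u v

-- d(u,v) ≥ k, where d is the graph distance (length of a shortest walk):
-- every walk from u to v has length at least k.
DistGE : ∀ {n} → Graph n → ℕ → Fin n → Fin n → Set
DistGE G k u v = ∀ (w : Walk G u v) → k ≤ walkLength w

-- A k-dispersed labelling: a bijection φ from labels to vertices such that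
-- consecutive labels are at distance ≥ k.  Labels 1..n are encoded as Fin n (0..n-1).
Dispersed : ∀ {n} → Graph n → ℕ → (Fin n → Fin n) → Set
Dispersed {n} G k φ =
  Bijective _≡_ _≡_ φ ×
  (∀ (i j : Fin n) → toℕ j ≡ suc (toℕ i) → DistGE G k (φ i) (φ j))

HasDispersed : ∀ {n} → Graph n → ℕ → Set
HasDispersed G k = ∃ λ φ → Dispersed G k φ

IsDL : ∀ {n} → Graph n → ℕ → Set
IsDL G k = HasDispersed G k × (∀ k′ → HasDispersed G k′ → k′ ≤ k)

CycleAdj : (n : ℕ) → Fin n → Fin n → Set
CycleAdj n i j =
  toℕ j ≡ suc (toℕ i) ⊎
  toℕ i ≡ suc (toℕ j) ⊎
  (toℕ i ≡ n ∸ 1 × toℕ j ≡ 0) ⊎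
  (toℕ j ≡ n ∸ 1 × toℕ i ≡ 0)

Cycle : (n : ℕ) → Graph n
Cycle n = record { Adj = CycleAdj n }

-- A walk in C_n moves one step around the cycle at a time, so it must be at least as long as the
-- cyclic distance min(d, n − d) between its ends, where d = |u − v|; conversely both arcs are walks.
-- Hence d(u, v) ≥ k exactly when k ≤ d and k + d ≤ n. In particular 2k ≤ n for consecutive labels,
-- which settles odd n = 2m + 1. For even n = 2m + 2, the value k = m + 1 would force every pair of
-- consecutive labels to be antipodal, so labels 1 and 3 would coincide. The labelling
-- 0, m + 1, 1, m + 2, 2, … alternates offsets m + 1 and m and attains k = m in both cases.
module Submission where

open import Defs
open import Data.Nat
  using (ℕ; zero; suc; _+_; _*_; _∸_; _%_; _/_; _≤_; _<_; _≤?_; z≤n; s≤s; s≤s⁻¹)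
open import Data.Nat.Properties
open import Data.Nat.DivMod using (m≡m%n+[m/n]*n; m*n/n≡m)
open import Data.Fin using (Fin; toℕ; fromℕ; fromℕ<) renaming (zero to fzero; suc to fsuc)
open import Data.Fin.Properties using (toℕ<n; toℕ-fromℕ; toℕ-fromℕ<; toℕ-injective)
open import Data.Product using (Σ; ∃-syntax; _×_; _,_)
open import Data.Sum using (_⊎_; inj₁; inj₂; [_,_]′)
import Data.Sum as Sum
open import Function.Bundles using (Bijection; mk↔ₛ′)
open import Function.Definitions using (Bijective)
open import Function.Properties.Inverse using (↔⇒⤖)
open import Relation.Binary.Definitions using (Symmetric)
open import Relation.Nullary using (¬_; yes; no; contradiction)
open import Relation.Binary.PropositionalEquality

*2≡+ : ∀ m → m * 2 ≡ m + m
*2≡+ m = trans (*-suc m 1) (cong (m +_) (*-identityʳ m))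

Offset : ℕ → ℕ → ℕ → Set
Offset d a b = a + d ≡ b ⊎ b + d ≡ a

offset : ∀ a b → ∃[ d ] Offset d a b
offset a b with ≤-total a b
... | inj₁ a≤b = _ , inj₁ (m+[n∸m]≡n a≤b)
... | inj₂ b≤a = _ , inj₂ (m+[n∸m]≡n b≤a)

offset-suc : ∀ {d a b} → Offset d a b → Offset d (suc a) (suc b)
offset-suc = Sum.map (cong suc) (cong suc)

WalkOfLength : ∀ {n} → Graph n → ℕ → Fin n → Fin n → Set
WalkOfLength G d u v = Σ (Walk G u v) (λ w → walkLength w ≡ d)

module _ {n} {G : Graph n} where

  _++_ : ∀ {u v w} → Walk G u v → Walk G v w → Walk G u w
  [] ++ q = q
  (e ∷ p) ++ q = e ∷ (p ++ q)

  length-++ : ∀ {u v w} (p : Walk G u v) (q : Walk G v w) →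
              walkLength (p ++ q) ≡ walkLength p + walkLength q
  length-++ [] q = refl
  length-++ (e ∷ p) q = cong suc (length-++ p q)

  reverse : Symmetric (Adj G) → ∀ {u v} → Walk G u v → Walk G v u
  reverse sym [] = []
  reverse sym (e ∷ p) = reverse sym p ++ (sym e ∷ [])

  length-reverse : (sym : Symmetric (Adj G)) → ∀ {u v} (p : Walk G u v) →
                   walkLength (reverse sym p) ≡ walkLength p
  length-reverse sym [] = refl
  length-reverse sym (e ∷ p) = begin
    walkLength (reverse sym p ++ (sym e ∷ []))  ≡⟨ length-++ (reverse sym p) _ ⟩
    walkLength (reverse sym p) + 1              ≡⟨ +-comm _ 1 ⟩
    suc (walkLength (reverse sym p))            ≡⟨ cong suc (length-reverse sym p) ⟩
    suc (walkLength p)                          ∎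
    where open ≡-Reasoning

  _∷ᴸ_ : ∀ {d u v w} → Adj G u v → WalkOfLength G d v w → WalkOfLength G (suc d) u w
  e ∷ᴸ (p , refl) = e ∷ p , refl

  _++ᴸ_ : ∀ {d e u v w} → WalkOfLength G d u v → WalkOfLength G e v w → WalkOfLength G (d + e) u w
  (p , refl) ++ᴸ (q , refl) = p ++ q , length-++ p q

  distGE-≤ : ∀ {k d u v} → DistGE G k u v → WalkOfLength G d u v → k ≤ d
  distGE-≤ D (p , refl) = D p

  distGE-sym : Symmetric (Adj G) → ∀ {k u v} → DistGE G k u v → DistGE G k v u
  distGE-sym sym {k} D p = subst (k ≤_) (length-reverse sym p) (D (reverse sym p))

module _ {n′ : ℕ} where

  private
    n : ℕ
    n = suc n′

  cycle-sym : Symmetric (CycleAdj n)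
  cycle-sym (inj₁ e) = inj₂ (inj₁ e)
  cycle-sym (inj₂ (inj₁ e)) = inj₁ e
  cycle-sym (inj₂ (inj₂ (inj₁ e))) = inj₂ (inj₂ (inj₂ e))
  cycle-sym (inj₂ (inj₂ (inj₂ e))) = inj₂ (inj₂ (inj₁ e))

  ascending-walk : ∀ d (u v : Fin n) → toℕ u + d ≡ toℕ v → WalkOfLength (Cycle n) d u v
  ascending-walk zero u v e rewrite toℕ-injective (trans (sym (+-identityʳ (toℕ u))) e) = [] , refl
  ascending-walk (suc d) u v e =
    inj₁ (toℕ-fromℕ< u+1<n)
      ∷ᴸ ascending-walk d (fromℕ< u+1<n) v (trans (cong (_+ d) (toℕ-fromℕ< u+1<n)) e′)
    where
      e′ : suc (toℕ u) + d ≡ toℕ v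
      e′ = trans (sym (+-suc (toℕ u) d)) e
      u+1<n : suc (toℕ u) < n
      u+1<n = ≤-<-trans (≤-trans (m≤m+n _ d) (≤-reflexive e′)) (toℕ<n v)

  ascending-distGE⇒gap-bounds : ∀ {k d} {u v : Fin n} → DistGE (Cycle n) k u v → toℕ u + d ≡ toℕ v →
                         k ≤ d × k + d ≤ n
  ascending-distGE⇒gap-bounds {k} {d} {u} {v} D e = distGE-≤ D (ascending-walk d u v e) , k+d≤n
    where
      v≤n′ : toℕ v ≤ n′
      v≤n′ = s≤s⁻¹ (toℕ<n v)
      around : WalkOfLength (Cycle n) (n′ ∸ toℕ v + suc (toℕ u)) v u
      around = ascending-walk (n′ ∸ toℕ v) v (fromℕ n′) (trans (m+[n∸m]≡n v≤n′) (sym (toℕ-fromℕ n′)))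
               ++ᴸ (inj₂ (inj₂ (inj₁ (toℕ-fromℕ n′ , refl))) ∷ᴸ ascending-walk (toℕ u) fzero u refl)
      around+d≡n : n′ ∸ toℕ v + suc (toℕ u) + d ≡ n
      around+d≡n = begin
        n′ ∸ toℕ v + suc (toℕ u) + d  ≡⟨ +-assoc (n′ ∸ toℕ v) _ d ⟩
        n′ ∸ toℕ v + suc (toℕ u + d)  ≡⟨ cong (λ x → n′ ∸ toℕ v + suc x) e ⟩
        n′ ∸ toℕ v + suc (toℕ v)      ≡⟨ +-suc (n′ ∸ toℕ v) _ ⟩
        suc (n′ ∸ toℕ v + toℕ v)      ≡⟨ cong suc (m∸n+n≡m v≤n′) ⟩
        n                             ∎
        where open ≡-Reasoning
      k+d≤n : k + d ≤ n
      k+d≤n = ≤-trans (+-monoˡ-≤ d (distGE-≤ (distGE-sym cycle-sym D) around)) (≤-reflexive around+d≡n)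

  distGE⇒gap-bounds : ∀ {k d} {u v : Fin n} → DistGE (Cycle n) k u v → Offset d (toℕ u) (toℕ v) →
                      k ≤ d × k + d ≤ n
  distGE⇒gap-bounds D (inj₁ e) = ascending-distGE⇒gap-bounds D e
  distGE⇒gap-bounds D (inj₂ e) = ascending-distGE⇒gap-bounds (distGE-sym cycle-sym D) e

  distGE-gap : ∀ {k} {u v : Fin n} → DistGE (Cycle n) k u v →
               ∃[ d ] Offset d (toℕ u) (toℕ v) × k ≤ d × k + d ≤ n
  distGE-gap {u = u} {v} D with offset (toℕ u) (toℕ v)
  ... | d , o = d , o , distGE⇒gap-bounds D o

  -- The cyclic distance min(|a − c|, n − |a − c|) between positions a, c < n is at most t.
  Near : ℕ → ℕ → ℕ → Set
  Near t a c = (a ≤ t + c × c ≤ t + a) ⊎ n + a ≤ t + c ⊎ n + c ≤ t + a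

  near-sym : ∀ {t a c} → Near t a c → Near t c a
  near-sym (inj₁ (p , q)) = inj₁ (q , p)
  near-sym (inj₂ (inj₁ p)) = inj₂ (inj₂ p)
  near-sym (inj₂ (inj₂ p)) = inj₂ (inj₁ p)

  near-down : ∀ {t a c} → Near t (suc a) c → Near (suc t) a c
  near-down {t} {a} (inj₁ (p , q)) =
    inj₁ (m≤n⇒m≤1+n (≤-trans (n≤1+n a) p) , ≤-trans q (≤-reflexive (+-suc t a)))
  near-down {a = a} (inj₂ (inj₁ p)) = inj₂ (inj₁ (m≤n⇒m≤1+n (≤-trans (+-monoʳ-≤ n (n≤1+n a)) p)))
  near-down {t} {a} (inj₂ (inj₂ p)) = inj₂ (inj₂ (≤-trans p (≤-reflexive (+-suc t a))))

  near-up : ∀ {t a c} → Near t a c → Near (suc t) (suc a) c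
  near-up {t} {a} (inj₁ (p , q)) = inj₁ (s≤s p , m≤n⇒m≤1+n (≤-trans q (+-monoʳ-≤ t (n≤1+n a))))
  near-up {a = a} (inj₂ (inj₁ p)) = inj₂ (inj₁ (≤-trans (≤-reflexive (+-suc n a)) (s≤s p)))
  near-up {t} {a} (inj₂ (inj₂ p)) = inj₂ (inj₂ (m≤n⇒m≤1+n (≤-trans p (+-monoʳ-≤ t (n≤1+n a)))))

  near-zero : ∀ {t c} → c ≤ t → Near (suc t) 0 c
  near-zero {t} c≤t = inj₁ (z≤n , m≤n⇒m≤1+n (≤-trans c≤t (≤-reflexive (sym (+-identityʳ t)))))

  near-top : ∀ {t c} → c < n → Near t 0 c → Near (suc t) n′ c
  near-top {t} _ (inj₁ (_ , c≤t+0)) =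
    inj₂ (inj₂ (s≤s (≤-trans (+-monoʳ-≤ n′ (≤-trans c≤t+0 (≤-reflexive (+-identityʳ t))))
                             (≤-reflexive (+-comm n′ t)))))
  near-top {t} c<n (inj₂ (inj₁ n+0≤t+c)) =
    inj₁ (≤-trans (≤-trans (n≤1+n n′) (≤-reflexive (sym (+-identityʳ n)))) (m≤n⇒m≤1+n n+0≤t+c)
         , m≤n⇒m≤1+n (≤-trans (s≤s⁻¹ c<n) (m≤n+m n′ t)))
  near-top {t} {c} c<n (inj₂ (inj₂ n+c≤t+0)) =
    inj₁ (m≤n⇒m≤1+n (≤-trans n′≤t (m≤m+n t c))
         , m≤n⇒m≤1+n (≤-trans (<⇒≤ (<-≤-trans c<n n≤t)) (m≤m+n t n′)))
    where
      n≤t : n ≤ t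
      n≤t = ≤-trans (m≤m+n n c) (≤-trans n+c≤t+0 (≤-reflexive (+-identityʳ t)))
      n′≤t : n′ ≤ t
      n′≤t = ≤-trans (n≤1+n n′) n≤t

  near-bottom : ∀ {t c} → c < n → Near t n′ c → Near (suc t) 0 c
  near-bottom _ (inj₁ (n′≤t+c , _)) =
    inj₂ (inj₁ (≤-trans (≤-reflexive (+-identityʳ n)) (s≤s n′≤t+c)))
  near-bottom {t} c<n (inj₂ (inj₁ n+n′≤t+c)) = near-zero (<⇒≤ (<-≤-trans c<n n≤t))
    where
      n≤t : n ≤ t
      n≤t = +-cancelʳ-≤ n′ n t (≤-trans n+n′≤t+c (+-monoʳ-≤ t (s≤s⁻¹ c<n)))
  near-bottom {t} {c} c<n (inj₂ (inj₂ n+c≤t+n′)) =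
    near-zero (+-cancelʳ-≤ n′ c t (≤-trans (m≤n⇒m≤1+n (≤-reflexive (+-comm c n′))) n+c≤t+n′))

  near-step : ∀ {t a b c} → c < n → (b ≡ suc a ⊎ a ≡ suc b ⊎ (a ≡ n′ × b ≡ 0) ⊎ (b ≡ n′ × a ≡ 0)) →
              Near t b c → Near (suc t) a c
  near-step _ (inj₁ refl) = near-down
  near-step _ (inj₂ (inj₁ refl)) = near-up
  near-step c<n (inj₂ (inj₂ (inj₁ (refl , refl)))) = near-top c<n
  near-step c<n (inj₂ (inj₂ (inj₂ (refl , refl)))) = near-bottom c<n

  walk-near : ∀ {u v : Fin n} (p : Walk (Cycle n) u v) → Near (walkLength p) (toℕ u) (toℕ v)
  walk-near [] = inj₁ (≤-refl , ≤-refl)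
  walk-near {v = v} (e ∷ p) = near-step (toℕ<n v) e (walk-near p)

  near-offset : ∀ {t a d} → Near t a (a + d) → d ≤ t ⊎ n ≤ d + t
  near-offset {t} {a} {d} (inj₁ (_ , a+d≤t+a)) =
    inj₁ (+-cancelˡ-≤ a d t (≤-trans a+d≤t+a (≤-reflexive (+-comm t a))))
  near-offset {t} {a} {d} (inj₂ (inj₁ n+a≤t+[a+d])) =
    inj₂ (+-cancelˡ-≤ a n (d + t) (subst₂ _≤_ (+-comm n a) rearrange n+a≤t+[a+d]))
    where
      rearrange : t + (a + d) ≡ a + (d + t)
      rearrange = trans (+-comm t (a + d)) (+-assoc a d t)
  near-offset {t} {a} {d} (inj₂ (inj₂ n+[a+d]≤t+a)) =
    inj₁ (+-cancelʳ-≤ a d t (≤-trans (≤-trans (≤-reflexive (+-comm d a)) (m≤n+m (a + d) n)) n+[a+d]≤t+a))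

  ascending-gap-bounds⇒distGE : ∀ {k d} {u v : Fin n} → toℕ u + d ≡ toℕ v → k ≤ d → k + d ≤ n →
                                DistGE (Cycle n) k u v
  ascending-gap-bounds⇒distGE {k} {d} e k≤d k+d≤n p =
    short-or-long (near-offset (subst (Near _ _) (sym e) (walk-near p)))
    where
      short-or-long : d ≤ walkLength p ⊎ n ≤ d + walkLength p → k ≤ walkLength p
      short-or-long (inj₁ d≤t) = ≤-trans k≤d d≤t
      short-or-long (inj₂ n≤d+t) =
        +-cancelʳ-≤ d k _ (≤-trans k+d≤n (≤-trans n≤d+t (≤-reflexive (+-comm d _))))

  gap-bounds⇒distGE : ∀ {k d} {u v : Fin n} → Offset d (toℕ u) (toℕ v) → k ≤ d → k + d ≤ n →
                      DistGE (Cycle n) k u v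
  gap-bounds⇒distGE (inj₁ e) k≤d k+d≤n = ascending-gap-bounds⇒distGE e k≤d k+d≤n
  gap-bounds⇒distGE (inj₂ e) k≤d k+d≤n =
    distGE-sym cycle-sym (ascending-gap-bounds⇒distGE e k≤d k+d≤n)

restrict : ∀ {n} (f : ℕ → ℕ) → (∀ {i} → i < n → f i < n) → Fin n → Fin n
restrict f f-< i = fromℕ< (f-< (toℕ<n i))

toℕ-restrict : ∀ {n} (f : ℕ → ℕ) (f-< : ∀ {i} → i < n → f i < n) (i : Fin n) →
               toℕ (restrict f f-< i) ≡ f (toℕ i)
toℕ-restrict f f-< i = toℕ-fromℕ< (f-< (toℕ<n i))

restrict-inverse : ∀ {n} {f g : ℕ → ℕ}
                   (f-< : ∀ {i} → i < n → f i < n) (g-< : ∀ {i} → i < n → g i < n) →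
                   (∀ {i} → i < n → f (g i) ≡ i) → ∀ i → restrict f f-< (restrict g g-< i) ≡ i
restrict-inverse {f = f} {g} f-< g-< f∘g i = toℕ-injective (begin
  toℕ (restrict f f-< (restrict g g-< i))  ≡⟨ toℕ-restrict f f-< _ ⟩
  f (toℕ (restrict g g-< i))               ≡⟨ cong f (toℕ-restrict g g-< i) ⟩
  f (g (toℕ i))                            ≡⟨ f∘g (toℕ<n i) ⟩
  toℕ i                                    ∎)
  where open ≡-Reasoning

restrict-bijective : ∀ {n} {f g : ℕ → ℕ}
                     (f-< : ∀ {i} → i < n → f i < n) (g-< : ∀ {i} → i < n → g i < n) →
                     (∀ {i} → i < n → f (g i) ≡ i) → (∀ {i} → i < n → g (f i) ≡ i) →
                     Bijective _≡_ _≡_ (restrict f f-<)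
restrict-bijective {f = f} {g} f-< g-< f∘g g∘f = Bijection.bijective (↔⇒⤖ (mk↔ₛ′
  (restrict f f-<) (restrict g g-<) (restrict-inverse f-< g-< f∘g) (restrict-inverse g-< f-< g∘f)))

data Parity : ℕ → Set where
  even : ∀ j → Parity (j * 2)
  odd : ∀ j → Parity (suc (j * 2))

parity : ∀ i → Parity i
parity zero = even 0
parity (suc i) with parity i
... | even j = odd j
... | odd j = even (suc j)

interleave : ℕ → ℕ → ℕ
interleave m zero = zero
interleave m (suc zero) = suc m
interleave m (suc (suc i)) = suc (interleave m i)

interleave-even : ∀ m j → interleave m (j * 2) ≡ j
interleave-even m zero = refl
interleave-even m (suc j) = cong suc (interleave-even m j)

interleave-odd : ∀ m j → interleave m (suc (j * 2)) ≡ j + suc m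
interleave-odd m zero = refl
interleave-odd m (suc j) = cong suc (interleave-odd m j)

interleave-step : ∀ m i → Offset (suc m) (interleave m i) (interleave m (suc i)) ⊎
                          Offset m (interleave m i) (interleave m (suc i))
interleave-step m zero = inj₁ (inj₁ refl)
interleave-step m (suc zero) = inj₂ (inj₂ refl)
interleave-step m (suc (suc i)) = Sum.map offset-suc offset-suc (interleave-step m i)

deinterleave : ℕ → ℕ → ℕ
deinterleave m v with v ≤? m
... | yes _ = v * 2
... | no _ = suc ((v ∸ suc m) * 2)

interleave-deinterleave : ∀ m v → interleave m (deinterleave m v) ≡ v
interleave-deinterleave m v with v ≤? m
... | yes _ = interleave-even m v
... | no v≰m = trans (interleave-odd m (v ∸ suc m)) (m∸n+n≡m (≰⇒> v≰m))

module _ (m : ℕ) {n : ℕ} (m*2<n : m * 2 < n) where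

  interleave-< : ∀ {i} → i < n → interleave m i < n
  interleave-< {i} i<n with parity i
  ... | even j = ≤-<-trans (≤-trans (≤-reflexive (interleave-even m j)) (m≤m*n j 2)) i<n
  ... | odd j rewrite interleave-odd m j with ≤-<-connex m j
  ...   | inj₁ m≤j = begin
    suc (j + suc m)      ≤⟨ s≤s (+-monoʳ-≤ j (s≤s m≤j)) ⟩
    suc (j + suc j)      ≡⟨ cong suc (+-suc j j) ⟩
    suc (suc (j + j))    ≡⟨ cong (λ x → suc (suc x)) (*2≡+ j) ⟨
    suc (suc (j * 2))    ≤⟨ i<n ⟩
    n                    ∎
    where open ≤-Reasoning
  ...   | inj₂ j<m = begin
    suc j + suc m        ≤⟨ +-monoˡ-≤ (suc m) j<m ⟩
    m + suc m            ≡⟨ +-suc m m ⟩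
    suc (m + m)          ≡⟨ cong suc (*2≡+ m) ⟨
    suc (m * 2)          ≤⟨ m*2<n ⟩
    n                    ∎
    where open ≤-Reasoning

  module _ (n≤[1+m]*2 : n ≤ suc m * 2) where

    deinterleave-< : ∀ {v} → v < n → deinterleave m v < n
    deinterleave-< {v} v<n with v ≤? m
    ... | yes v≤m = <-≤-trans (s≤s (*-monoˡ-≤ 2 v≤m)) m*2<n
    ... | no v≰m = begin
      suc w * 2       ≡⟨ *2≡+ (suc w) ⟩
      suc w + suc w   ≤⟨ +-monoʳ-≤ (suc w) 1+w≤1+m ⟩
      suc w + suc m   ≡⟨ cong suc w+1+m≡v ⟩
      suc v           ≤⟨ v<n ⟩
      n               ∎
      where
        open ≤-Reasoning
        w : ℕ
        w = v ∸ suc m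
        w+1+m≡v : w + suc m ≡ v
        w+1+m≡v = m∸n+n≡m (≰⇒> v≰m)
        1+w≤1+m : suc w ≤ suc m
        1+w≤1+m = +-cancelʳ-≤ (suc m) (suc w) (suc m) (begin
          suc (w + suc m)  ≡⟨ cong suc w+1+m≡v ⟩
          suc v            ≤⟨ v<n ⟩
          n                ≤⟨ n≤[1+m]*2 ⟩
          suc m * 2        ≡⟨ *2≡+ (suc m) ⟩
          suc m + suc m    ∎)

    deinterleave-interleave : ∀ {i} → i < n → deinterleave m (interleave m i) ≡ i
    deinterleave-interleave {i} i<n with parity i
    ... | even j rewrite interleave-even m j with j ≤? m
    ...   | yes _ = refl
    ...   | no j≰m = contradiction j≤m j≰m
      where
        j≤m : j ≤ m
        j≤m = s≤s⁻¹ (*-cancelʳ-< 2 j (suc m) (<-≤-trans i<n n≤[1+m]*2))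
    deinterleave-interleave {i} i<n | odd j rewrite interleave-odd m j with j + suc m ≤? m
    ... | yes j+m+1≤m = contradiction j+m+1≤m (<⇒≱ (m≤n+m (suc m) j))
    ... | no _ = cong (λ x → suc (x * 2)) (m+n∸n≡m j (suc m))

interleaving-dispersed : ∀ {n′} m → m * 2 < suc n′ → suc n′ ≤ suc m * 2 →
                         HasDispersed (Cycle (suc n′)) m
interleaving-dispersed {n′} m m*2<n n≤[1+m]*2 = φ , bijective , consecutive
  where
    n : ℕ
    n = suc n′
    φ : Fin n → Fin n
    φ = restrict (interleave m) (interleave-< m m*2<n)
    bijective : Bijective _≡_ _≡_ φ
    bijective = restrict-bijective (interleave-< m m*2<n) (deinterleave-< m m*2<n n≤[1+m]*2)
                  (λ _ → interleave-deinterleave m _) (deinterleave-interleave m m*2<n n≤[1+m]*2)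
    m+[1+m]≤n : m + suc m ≤ n
    m+[1+m]≤n = begin
      m + suc m    ≡⟨ +-suc m m ⟩
      suc (m + m)  ≡⟨ cong suc (*2≡+ m) ⟨
      suc (m * 2)  ≤⟨ m*2<n ⟩
      n            ∎
      where open ≤-Reasoning
    m+m≤n : m + m ≤ n
    m+m≤n = ≤-trans (+-monoʳ-≤ m (n≤1+n m)) m+[1+m]≤n
    toℕ-φ : ∀ i → toℕ (φ i) ≡ interleave m (toℕ i)
    toℕ-φ = toℕ-restrict (interleave m) (interleave-< m m*2<n)
    consecutive : ∀ i j → toℕ j ≡ suc (toℕ i) → DistGE (Cycle n) m (φ i) (φ j)
    consecutive i j e = [ (λ o → gap-bounds⇒distGE (labels o) (n≤1+n m) m+[1+m]≤n)
                        , (λ o → gap-bounds⇒distGE (labels o) ≤-refl m+m≤n)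
                        ]′ (interleave-step m (toℕ i))
      where
        labels : ∀ {d} → Offset d (interleave m (toℕ i)) (interleave m (suc (toℕ i))) →
                 Offset d (toℕ (φ i)) (toℕ (φ j))
        labels {d} = subst₂ (Offset d) (sym (toℕ-φ i)) (sym (trans (toℕ-φ j) (cong (interleave m) e)))

odd-cycle-dispersion-≤ : ∀ {m k} → 0 < m → HasDispersed (Cycle (suc (m * 2))) k → k ≤ m
odd-cycle-dispersion-≤ {suc m} {k} _ (_ , _ , consecutive)
  with distGE-gap (consecutive fzero (fsuc fzero) refl)
... | d , _ , k≤d , k+d≤n = s≤s⁻¹ (*-cancelʳ-< 2 k (suc (suc m)) (begin-strict
  k * 2              ≡⟨ *2≡+ k ⟩
  k + k              ≤⟨ +-monoʳ-≤ k k≤d ⟩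
  k + d              ≤⟨ k+d≤n ⟩
  suc (suc m * 2)    <⟨ n<1+n _ ⟩
  suc (suc m) * 2    ∎))
  where open ≤-Reasoning

antipodal-gap : ∀ {h k d} → h ≤ k → k ≤ d → k + d ≤ h + h → d ≡ h
antipodal-gap {h} {d = d} h≤k k≤d k+d≤h+h =
  ≤-antisym (+-cancelˡ-≤ h d h (≤-trans (+-monoˡ-≤ d h≤k) k+d≤h+h)) (≤-trans h≤k k≤d)

m+n+n≮n+n : ∀ m n → ¬ (m + n + n < n + n)
m+n+n≮n+n m n = ≤⇒≯ (subst (n + n ≤_) (sym (+-assoc m n n)) (m≤n+m (n + n) m))

antipode-unique : ∀ {h a b c} → a < h + h → c < h + h → Offset h a b → Offset h b c → a ≡ c
antipode-unique {h} {a} _ c<h+h (inj₁ a+h≡b) (inj₁ b+h≡c) =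
  contradiction (subst (_< h + h) (sym (trans (cong (_+ h) a+h≡b) b+h≡c)) c<h+h) (m+n+n≮n+n a h)
antipode-unique {h} _ _ (inj₁ a+h≡b) (inj₂ c+h≡b) = +-cancelʳ-≡ h _ _ (trans a+h≡b (sym c+h≡b))
antipode-unique _ _ (inj₂ b+h≡a) (inj₁ b+h≡c) = trans (sym b+h≡a) b+h≡c
antipode-unique {h} {c = c} a<h+h _ (inj₂ b+h≡a) (inj₂ c+h≡b) =
  contradiction (subst (_< h + h) (sym (trans (cong (_+ h) c+h≡b) b+h≡a)) a<h+h) (m+n+n≮n+n c h)

even-cycle-dispersion-≤ : ∀ {m k} → 0 < m → HasDispersed (Cycle (suc m * 2)) k → k ≤ m
even-cycle-dispersion-≤ {suc m} {k} _ (φ , (injective , _) , consecutive) with k ≤? suc m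
... | yes k≤m = k≤m
... | no k≰m = contradiction (injective (toℕ-injective φ₀≡φ₂)) λ ()
  where
    h : ℕ
    h = suc (suc m)
    antipodal : ∀ i j → toℕ j ≡ suc (toℕ i) → Offset h (toℕ (φ i)) (toℕ (φ j))
    antipodal i j e with distGE-gap (consecutive i j e)
    ... | d , o , k≤d , k+d≤n = subst (λ x → Offset x _ _)
                                  (antipodal-gap (≰⇒> k≰m) k≤d (≤-trans k+d≤n (≤-reflexive (*2≡+ h)))) o
    position-< : ∀ i → toℕ (φ i) < h + h
    position-< i = <-≤-trans (toℕ<n (φ i)) (≤-reflexive (*2≡+ h))
    φ₀≡φ₂ : toℕ (φ fzero) ≡ toℕ (φ (fsuc (fsuc fzero)))
    φ₀≡φ₂ = antipode-unique (position-< _) (position-< _)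
              (antipodal fzero (fsuc fzero) refl) (antipodal (fsuc fzero) (fsuc (fsuc fzero)) refl)

odd-cycle-DL : ∀ {m} → 0 < m → IsDL (Cycle (suc (m * 2))) m
odd-cycle-DL {m} 0<m = interleaving-dispersed m ≤-refl (n≤1+n _) , λ _ → odd-cycle-dispersion-≤ 0<m

even-cycle-DL : ∀ {m} → 0 < m → IsDL (Cycle (suc m * 2)) m
even-cycle-DL {m} 0<m = interleaving-dispersed m (n≤1+n _) ≤-refl , λ _ → even-cycle-dispersion-≤ 0<m

theorem2p1 : (n : ℕ) → 3 ≤ n →
    (n % 2 ≡ 1 → IsDL (Cycle n) ((n ∸ 1) / 2)) ×
    (n % 2 ≡ 0 → IsDL (Cycle n) ((n ∸ 2) / 2))
theorem2p1 n 3≤n =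
  (λ n%2≡1 → odd-DL (n / 2) (n≡ n%2≡1) 3≤n) , (λ n%2≡0 → even-DL (n / 2) (n≡ n%2≡0) 3≤n)
  where
    n≡ : ∀ {r} → n % 2 ≡ r → n ≡ r + n / 2 * 2
    n≡ n%2≡r = trans (m≡m%n+[m/n]*n n 2) (cong (_+ n / 2 * 2) n%2≡r)
    odd-DL : ∀ {n} q → n ≡ suc (q * 2) → 3 ≤ n → IsDL (Cycle n) ((n ∸ 1) / 2)
    odd-DL zero refl (s≤s ())
    odd-DL (suc q) refl _ = subst (IsDL _) (sym (m*n/n≡m (suc q) 2)) (odd-cycle-DL (s≤s z≤n))
    even-DL : ∀ {n} q → n ≡ q * 2 → 3 ≤ n → IsDL (Cycle n) ((n ∸ 2) / 2)
    even-DL zero refl ()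
    even-DL (suc zero) refl (s≤s (s≤s ()))
    even-DL (suc (suc q)) refl _ = subst (IsDL _) (sym (m*n/n≡m (suc q) 2)) (even-cycle-DL (s≤s z≤n))
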